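{- For every positive integer $r$, $\kappa(K_{1,r})=2r+1$, where $K_{1,r}$ is a natural graph that is a star with one central vertex adjacent to $r$ leaves.
   Context: A natural graph is a simple graph whose vertex set is a finite subset of $\mathbb{N}=\{1,2,\dots\}$. An infinite permutation of $\mathbb{N}$ is a sequence $(\pi(1),\pi(2),\dots)$ in which every positive integer occurs exactly once. For a natural graph $G$, two infinite permutations $\pi,\sigma$ are $G$-different if $\{\pi(i),\sigma(i)\}\in E(G)$ for some $i$. $\kappa(G)$ is the maximum cardinality of a set of pairwise $G$-different infinite permutations. -}

module Defs where

open import Data.Nat using (ℕ; _≤_)
open import Data.Fin using (Fin)
open import Data.Product using (Σ; ∃; _×_)
open import Data.Sum using (_⊎_)
open import Function.Bundles using (_↔_; Inverse)
open import Relation.Binary.PropositionalEquality using (_≡_; _≢_)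

-- Positive integers 1,2,3,... are encoded by ℕ = {0,1,2,...} via n ↦ n+1
--.

Perm : Set
Perm = ℕ ↔ ℕ

-- A graph is given by its edge relation E on labels: E x y means {x,y} ∈ E(G).
-- π and σ are G-different if {π(i),σ(i)} ∈ E(G) for some i.
GDifferent : (ℕ → ℕ → Set) → Perm → Perm → Set
GDifferent E π σ = ∃ λ i → E (Inverse.to π i) (Inverse.to σ i)

-- A family of m pairwise G-different permutations (indexed injectively by Fin m;
-- injectivity is automatic since G has no loops).
PairwiseDifferent : (ℕ → ℕ → Set) → (m : ℕ) → (Fin m → Perm) → Set
PairwiseDifferent E m F = ∀ a b → a ≢ b → GDifferent E (F a) (F b)

KappaIs : (ℕ → ℕ → Set) → ℕ → Set
KappaIs E n =
  (Σ (Fin n → Perm) λ F → PairwiseDifferent E n F) ×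
  (∀ m (F : Fin m → Perm) → PairwiseDifferent E m F → m ≤ n)

-- The star K_{1,r} as a natural graph: centre c, leaves leaf 0 , … , leaf (r-1),
-- pairwise distinct and distinct from c. Edges: exactly {c, leaf j}.
StarEdge : (r : ℕ) → ℕ → (Fin r → ℕ) → ℕ → ℕ → Set
StarEdge r c leaf x y =
  (x ≡ c × ∃ λ j → leaf j ≡ y) ⊎ (y ≡ c × ∃ λ j → leaf j ≡ x)

-- Upper bound: in a family of pairwise K_{1,r}-different permutations π_a, let p_a be the
-- position of the centre in π_a. Two members can only differ at a position p_a, where the
-- other one shows a leaf; orient a → b when π_a(p_b) is a leaf. Every pair is then joined by
-- an arc, while the p_b are distinct, so π_a shows its r leaves at no more than r of them and
-- every out-degree is at most r; hence m(m − 1)/2 ≤ m r. Lower bound: the cyclic tournament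
-- on ℤ/(2r+1), where a beats a+1, …, a+r, is realised by permutations that put the centre at
-- position N + a and leaf j at position N + (a + j + 1 mod 2r+1), completed to bijections by
-- transpositions.
module Submission where

open import Defs
open import Data.Nat using (ℕ; _≤_; _+_; _*_)
open import Data.Fin using (Fin)
open import Function.Definitions using (Injective)
open import Relation.Binary.PropositionalEquality using (_≡_; _≢_)

open import Data.Empty using (⊥-elim)
open import Data.Fin using (zero; suc; toℕ; fromℕ<)
import Data.Fin.Properties as Finₚ
open Finₚ using (toℕ<n; toℕ-fromℕ<; toℕ-injective)
open import Data.Nat using (zero; suc; _∸_; _<_; _≟_; _≤?_; z≤n; s≤s; NonZero; >-nonZero)
open import Data.Nat.DivMod using (_%_; %-distribˡ-+; m%n%n≡m%n; [m+n]%n≡m%n; m<n⇒m%n≡m; m%n<n)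
open import Data.Nat.Properties
  using (+-mono-≤; m≤m+n; m≤n+m; ≤-trans; ≤-reflexive; *-cancelʳ-≤; *-identityʳ; +-comm; +-assoc; +-identityʳ; <⇒≤; ≰⇒>; suc-injective; 1+n≢0; n≢0⇒n>0; m<n⇒0<n∸m; m≤n+o⇒m∸n≤o; m+[n∸m]≡n; m∸n+n≡m; +-monoˡ-≤; +-cancelˡ-≡; <⇒≢; <-≤-trans; module ≤-Reasoning; +-0-commutativeMonoid)
open import Algebra.Properties.CommutativeMonoid.Sum +-0-commutativeMonoid
  using (sum-syntax; sum-cong-≗; ∑-distrib-+; ∑-comm)
open import Data.Nat.Tactic.RingSolver using (solve-∀)
open import Data.Product using (∃; _,_)
open import Data.Sum using (_⊎_; inj₁; inj₂)
import Data.Sum as Sum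
open import Data.Vec.Functional using (_∷_)
open import Function using (_∘_; id; _↔_; Inverse; Injection; mk↔ₛ′)
open import Function.Properties.Inverse using (↔-refl; ↔-trans; ↔⇒↣)
open import Relation.Binary.Definitions using (DecidableEquality)
open import Relation.Binary.PropositionalEquality using (refl; sym; trans; cong; cong₂; subst; module ≡-Reasoning)
open import Relation.Nullary using (Dec; yes; no)

∑-mono-≤ : ∀ {n} {f g : Fin n → ℕ} → (∀ i → f i ≤ g i) → ∑[ i < n ] f i ≤ ∑[ i < n ] g i
∑-mono-≤ {zero}  f≤g = z≤n
∑-mono-≤ {suc n} f≤g = +-mono-≤ (f≤g zero) (∑-mono-≤ (λ i → f≤g (suc i)))

≤-∑ : ∀ {n} (f : Fin n → ℕ) i → f i ≤ ∑[ k < n ] f k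
≤-∑ f zero    = m≤m+n _ _
≤-∑ f (suc i) = ≤-trans (≤-∑ (λ k → f (suc k)) i) (m≤n+m _ _)

∑-const : ∀ n k → ∑[ i < n ] k ≡ n * k
∑-const zero    k = refl
∑-const (suc n) k = cong (k +_) (∑-const n k)

𝟙 : ∀ {p} {P : Set p} → Dec P → ℕ
𝟙 (yes _) = 1
𝟙 (no _)  = 0

𝟙-yes : ∀ {p} {P : Set p} (d : Dec P) → P → 1 ≤ 𝟙 d
𝟙-yes (yes _) _ = s≤s z≤n
𝟙-yes (no ¬p) p = ⊥-elim (¬p p)

module _ {a} {A : Set a} (_≟_ : DecidableEquality A) where

  ∑-𝟙-absent : ∀ {n} (g : Fin n → A) {x} → (∀ i → x ≢ g i) → ∑[ i < n ] 𝟙 (x ≟ g i) ≡ 0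
  ∑-𝟙-absent {zero}  g x∉g = refl
  ∑-𝟙-absent {suc n} g {x} x∉g with x ≟ g zero
  ... | yes x≡g₀ = ⊥-elim (x∉g zero x≡g₀)
  ... | no  _    = ∑-𝟙-absent (λ i → g (suc i)) (λ i → x∉g (suc i))

  injective⇒∑-𝟙-≤1 : ∀ {n} (g : Fin n → A) → Injective _≡_ _≡_ g →
                     ∀ x → ∑[ i < n ] 𝟙 (x ≟ g i) ≤ 1
  injective⇒∑-𝟙-≤1 {zero}  g g-inj x = z≤n
  injective⇒∑-𝟙-≤1 {suc n} g g-inj x with x ≟ g zero
  ... | yes refl = s≤s (≤-reflexive (∑-𝟙-absent (λ i → g (suc i)) (λ i → Finₚ.0≢1+n ∘ g-inj)))
  ... | no  _    = injective⇒∑-𝟙-≤1 (λ i → g (suc i)) (λ eq → Finₚ.suc-injective (g-inj eq)) x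

∑-distrib-+₃ : ∀ {n} (f g h : Fin n → ℕ) →
               ∑[ i < n ] (f i + g i + h i) ≡ ∑[ i < n ] f i + ∑[ i < n ] g i + ∑[ i < n ] h i
∑-distrib-+₃ f g h =
  trans (∑-distrib-+ (λ i → f i + g i) h) (cong (_+ ∑[ i < _ ] h i) (∑-distrib-+ f g))

tournament-bound : ∀ {m} r (w : Fin m → Fin m → ℕ) →
                   (∀ a b → a ≢ b → 1 ≤ w a b ⊎ 1 ≤ w b a) →
                   (∀ a → ∑[ b < m ] w a b ≤ r) →
                   m ≤ 2 * r + 1
tournament-bound {zero}      r w joined out≤r = z≤n
tournament-bound {m@(suc _)} r w joined out≤r = *-cancelʳ-≤ m (2 * r + 1) m (begin
  m * m                                             ≡⟨ cong (m *_) (*-identityʳ m) ⟨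
  m * (m * 1)                                       ≡⟨ ∑-const m (m * 1) ⟨
  ∑[ a < m ] (m * 1)                                ≡⟨ sum-cong-≗ {m} (λ _ → ∑-const m 1) ⟨
  ∑[ a < m ] ∑[ b < m ] 1                           ≤⟨ ∑-mono-≤ (λ a → ∑-mono-≤ (covered a)) ⟩
  ∑[ a < m ] ∑[ b < m ] (w a b + w b a + loop a b)  ≡⟨ sum-cong-≗ {m} (λ a → ∑-distrib-+₃ (w a) (λ b → w b a) (loop a)) ⟩
  ∑[ a < m ] (out a + in′ a + loops a)              ≡⟨ ∑-distrib-+₃ out in′ loops ⟩
  ∑[ a < m ] out a + ∑[ a < m ] in′ a + ∑[ a < m ] loops a
    ≤⟨ +-mono-≤ (+-mono-≤ (∑-mono-≤ out≤r) (≤-trans (≤-reflexive (∑-comm {m} {m} (λ a b → w b a))) (∑-mono-≤ out≤r)))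
                (∑-mono-≤ loops≤1) ⟩
  ∑[ a < m ] r + ∑[ a < m ] r + ∑[ a < m ] 1        ≡⟨ cong₂ _+_ (cong₂ _+_ (∑-const m r) (∑-const m r)) (∑-const m 1) ⟩
  m * r + m * r + m * 1                             ≡⟨ regroup m r ⟩
  (2 * r + 1) * m                                   ∎)
  where
  open ≤-Reasoning

  loop : Fin m → Fin m → ℕ
  loop a b = 𝟙 (a Finₚ.≟ b)

  out in′ loops : Fin m → ℕ
  out   a = ∑[ b < m ] w a b
  in′   a = ∑[ b < m ] w b a
  loops a = ∑[ b < m ] loop a b

  loops≤1 : ∀ a → loops a ≤ 1
  loops≤1 = injective⇒∑-𝟙-≤1 Finₚ._≟_ {m} id id

  covered : ∀ a b → 1 ≤ w a b + w b a + loop a b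
  covered a b with a Finₚ.≟ b
  ... | yes _ = m≤n+m 1 _
  ... | no a≢b with joined a b a≢b
  ...   | inj₁ 1≤wab = ≤-trans 1≤wab (≤-trans (m≤m+n _ _) (m≤m+n _ _))
  ...   | inj₂ 1≤wba = ≤-trans 1≤wba (≤-trans (m≤n+m (w b a) (w a b)) (m≤m+n _ _))

  regroup : ∀ m r → m * r + m * r + m * 1 ≡ (2 * r + 1) * m
  regroup = solve-∀

module CentrePositions {r c : ℕ} {leaf : Fin r → ℕ} (leaf≢c : ∀ j → leaf j ≢ c)
                       {m} (π : Fin m → Perm) (different : PairwiseDifferent (StarEdge r c leaf) m π) where

  to : Fin m → ℕ → ℕ
  to a = Inverse.to (π a)

  centre : Fin m → ℕ
  centre a = Inverse.from (π a) c

  to-centre : ∀ a → to a (centre a) ≡ c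
  to-centre a = Inverse.strictlyInverseˡ (π a) c

  at-centre : ∀ a {i} → to a i ≡ c → i ≡ centre a
  at-centre a eq = sym (Inverse.inverseʳ (π a) (sym eq))

  IsLeaf : ℕ → Set
  IsLeaf x = ∃ λ j → leaf j ≡ x

  centre-meets-leaf : ∀ a b → a ≢ b → IsLeaf (to b (centre a)) ⊎ IsLeaf (to a (centre b))
  centre-meets-leaf a b a≢b with different a b a≢b
  ... | i , inj₁ (πa-i≡c , j , leaf≡πb-i) = inj₁ (j , trans leaf≡πb-i (cong (to b) (at-centre a πa-i≡c)))
  ... | i , inj₂ (πb-i≡c , j , leaf≡πa-i) = inj₂ (j , trans leaf≡πa-i (cong (to a) (at-centre b πb-i≡c)))

  centre-injective : Injective _≡_ _≡_ centre
  centre-injective {a} {b} centre-a≡centre-b with a Finₚ.≟ b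
  ... | yes a≡b = a≡b
  ... | no  a≢b with centre-meets-leaf a b a≢b
  ...   | inj₁ (j , e) = ⊥-elim (leaf≢c j (trans e (trans (cong (to b) centre-a≡centre-b) (to-centre b))))
  ...   | inj₂ (j , e) = ⊥-elim (leaf≢c j (trans e (trans (cong (to a) (sym centre-a≡centre-b)) (to-centre a))))

  leafCount : ℕ → ℕ
  leafCount x = ∑[ j < r ] 𝟙 (leaf j ≟ x)

  leaf⇒1≤leafCount : ∀ {x} → IsLeaf x → 1 ≤ leafCount x
  leaf⇒1≤leafCount {x} (j , leaf-j≡x) =
    ≤-trans (𝟙-yes (leaf j ≟ x) leaf-j≡x) (≤-∑ (λ k → 𝟙 (leaf k ≟ x)) j)

  joined : ∀ a b → a ≢ b → 1 ≤ leafCount (to a (centre b)) ⊎ 1 ≤ leafCount (to b (centre a))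
  joined a b a≢b = Sum.swap (Sum.map leaf⇒1≤leafCount leaf⇒1≤leafCount (centre-meets-leaf a b a≢b))

  outdegree≤r : ∀ a → ∑[ b < m ] leafCount (to a (centre b)) ≤ r
  outdegree≤r a = begin
    ∑[ b < m ] ∑[ j < r ] 𝟙 (leaf j ≟ to a (centre b)) ≡⟨ ∑-comm {m} {r} (λ b j → 𝟙 (leaf j ≟ to a (centre b))) ⟩
    ∑[ j < r ] ∑[ b < m ] 𝟙 (leaf j ≟ to a (centre b)) ≤⟨ ∑-mono-≤ {r} (λ j → injective⇒∑-𝟙-≤1 _≟_ (to a ∘ centre)
                                                           (centre-injective ∘ Injection.injective (↔⇒↣ (π a))) (leaf j)) ⟩
    ∑[ j < r ] 1                                        ≡⟨ ∑-const r 1 ⟩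
    r * 1                                               ≡⟨ *-identityʳ r ⟩
    r                                                   ∎
    where open ≤-Reasoning

star-pairwiseDifferent⇒≤ : ∀ {r c} {leaf : Fin r → ℕ} → (∀ j → leaf j ≢ c) →
                           ∀ m (π : Fin m → Perm) → PairwiseDifferent (StarEdge r c leaf) m π →
                           m ≤ 2 * r + 1
star-pairwiseDifferent⇒≤ {r} leaf≢c m π different =
  tournament-bound r (λ a b → leafCount (to a (centre b))) joined outdegree≤r
  where open CentrePositions leaf≢c π different

∷-injective : ∀ {a} {A : Set a} {n} {x : A} {f : Fin n → A} →
              (∀ j → f j ≢ x) → Injective _≡_ _≡_ f → Injective _≡_ _≡_ (x ∷ f)
∷-injective f≢x f-inj {zero}  {zero}  _  = refl
∷-injective f≢x f-inj {zero}  {suc j} eq = ⊥-elim (f≢x j (sym eq))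
∷-injective f≢x f-inj {suc i} {zero}  eq = ⊥-elim (f≢x i eq)
∷-injective f≢x f-inj {suc i} {suc j} eq = cong suc (f-inj eq)

module _ {a} {A : Set a} (_≟_ : DecidableEquality A) where

  transpose : A → A → A → A
  transpose x y z with z ≟ x
  ... | yes _ = y
  ... | no  _ with z ≟ y
  ...   | yes _ = x
  ...   | no  _ = z

  transpose-sendsˡ : ∀ x y → transpose x y x ≡ y
  transpose-sendsˡ x y with x ≟ x
  ... | yes _   = refl
  ... | no  x≢x = ⊥-elim (x≢x refl)

  transpose-sendsʳ : ∀ x y → transpose x y y ≡ x
  transpose-sendsʳ x y with y ≟ x
  ... | yes y≡x = y≡x
  ... | no  _ with y ≟ y
  ...   | yes _   = refl
  ...   | no  y≢y = ⊥-elim (y≢y refl)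

  transpose-fixes : ∀ x y {z} → z ≢ x → z ≢ y → transpose x y z ≡ z
  transpose-fixes x y {z} z≢x z≢y with z ≟ x
  ... | yes z≡x = ⊥-elim (z≢x z≡x)
  ... | no  _ with z ≟ y
  ...   | yes z≡y = ⊥-elim (z≢y z≡y)
  ...   | no  _   = refl

  transpose-involutive : ∀ x y z → transpose x y (transpose x y z) ≡ z
  transpose-involutive x y z = by-cases (z ≟ x) (z ≟ y)
    where
    by-cases : Dec (z ≡ x) → Dec (z ≡ y) → transpose x y (transpose x y z) ≡ z
    by-cases (yes refl) _          = trans (cong (transpose z y) (transpose-sendsˡ z y)) (transpose-sendsʳ z y)
    by-cases (no _)     (yes refl) = trans (cong (transpose x z) (transpose-sendsʳ x z)) (transpose-sendsˡ x z)
    by-cases (no z≢x)   (no z≢y)   =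
      trans (cong (transpose x y) (transpose-fixes x y z≢x z≢y)) (transpose-fixes x y z≢x z≢y)

  transposition : A → A → A ↔ A
  transposition x y = mk↔ₛ′ (transpose x y) (transpose x y) (transpose-involutive x y) (transpose-involutive x y)

  transpositions : ∀ {n} → (Fin n → A) → (Fin n → A) → A ↔ A
  transpositions {zero}  P V = ↔-refl
  transpositions {suc n} P V = ↔-trans (transpositions (P ∘ suc) (V ∘ suc)) (transposition (P zero) (V zero))

  transpositions-fixes : ∀ {n} (P V : Fin n → A) {z} → (∀ k → z ≢ P k) → (∀ k → z ≢ V k) →
                         Inverse.to (transpositions P V) z ≡ z
  transpositions-fixes {zero}  P V z∉P z∉V = refl
  transpositions-fixes {suc n} P V z∉P z∉V =
    trans (cong (transpose (P zero) (V zero)) (transpositions-fixes (P ∘ suc) (V ∘ suc) (z∉P ∘ suc) (z∉V ∘ suc)))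
          (transpose-fixes (P zero) (V zero) (z∉P zero) (z∉V zero))

  transpositions-maps : ∀ {n} (P V : Fin n → A) → (∀ k l → P k ≢ V l) →
                        Injective _≡_ _≡_ P → Injective _≡_ _≡_ V →
                        ∀ k → Inverse.to (transpositions P V) (P k) ≡ V k
  transpositions-maps P V P∩V P-inj V-inj zero =
    trans (cong (transpose (P zero) (V zero))
                (transpositions-fixes (P ∘ suc) (V ∘ suc) (λ k → Finₚ.0≢1+n ∘ P-inj) (λ l → P∩V zero (suc l))))
          (transpose-sendsˡ (P zero) (V zero))
  transpositions-maps P V P∩V P-inj V-inj (suc k) =
    trans (cong (transpose (P zero) (V zero))
                (transpositions-maps (P ∘ suc) (V ∘ suc) (λ k l → P∩V (suc k) (suc l))
                                     (Finₚ.suc-injective ∘ P-inj) (Finₚ.suc-injective ∘ V-inj) k))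
          (transpose-fixes (P zero) (V zero) (P∩V zero (suc k) ∘ sym) (Finₚ.0≢1+n ∘ V-inj ∘ sym))

module CyclicTournament (r : ℕ) where

  M : ℕ
  M = 2 * r + 1

  M≡1+r+r : M ≡ suc r + r
  M≡1+r+r = trans (+-comm (2 * r) 1) (cong (λ x → 1 + (r + x)) (+-identityʳ r))

  instance
    M-nonZero : NonZero M
    M-nonZero = >-nonZero (m≤n+m 1 (2 * r))

  open ≡-Reasoning

  rot : ℕ → ℕ → ℕ
  rot A k = (A + k) % M

  rot-comm : ∀ A k → rot A k ≡ rot k A
  rot-comm A k = cong (_% M) (+-comm A k)

  rot-rot : ∀ A k l → rot (rot A k) l ≡ rot A (k + l)
  rot-rot A k l = begin
    ((A + k) % M + l) % M          ≡⟨ %-distribˡ-+ ((A + k) % M) l M ⟩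
    ((A + k) % M % M + l % M) % M  ≡⟨ cong (λ x → (x + l % M) % M) (m%n%n≡m%n (A + k) M) ⟩
    ((A + k) % M + l % M) % M      ≡⟨ %-distribˡ-+ (A + k) l M ⟨
    (A + k + l) % M                ≡⟨ cong (_% M) (+-assoc A k l) ⟩
    (A + (k + l)) % M              ∎

  rot-zero : ∀ {A} → A < M → rot A 0 ≡ A
  rot-zero {A} A<M = trans (cong (_% M) (+-identityʳ A)) (m<n⇒m%n≡m A<M)

  rot-back : ∀ A {k} → k ≤ M → rot (rot A k) (M ∸ k) ≡ A % M
  rot-back A {k} k≤M = begin
    rot (rot A k) (M ∸ k)    ≡⟨ rot-rot A k (M ∸ k) ⟩
    (A + (k + (M ∸ k))) % M  ≡⟨ cong (λ x → (A + x) % M) (m+[n∸m]≡n k≤M) ⟩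
    (A + M) % M              ≡⟨ [m+n]%n≡m%n A M ⟩
    A % M                    ∎

  rot-injective : ∀ {A k l} → A < M → k < M → l < M → rot A k ≡ rot A l → k ≡ l
  rot-injective {A} {k} {l} A<M k<M l<M eq = begin
    k                      ≡⟨ m<n⇒m%n≡m k<M ⟨
    k % M                  ≡⟨ rot-back k (<⇒≤ A<M) ⟨
    rot (rot k A) (M ∸ A)  ≡⟨ cong (λ x → rot x (M ∸ A)) (trans (rot-comm k A) (trans eq (rot-comm A l))) ⟩
    rot (rot l A) (M ∸ A)  ≡⟨ rot-back l (<⇒≤ A<M) ⟩
    l % M                  ≡⟨ m<n⇒m%n≡m l<M ⟩
    l                      ∎

  rot-distance : ∀ {A B} → A ≤ M → B < M → rot A (rot B (M ∸ A)) ≡ B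
  rot-distance {A} {B} A≤M B<M = begin
    rot A (rot B (M ∸ A))   ≡⟨ rot-comm A _ ⟩
    rot (rot B (M ∸ A)) A   ≡⟨ rot-rot B (M ∸ A) A ⟩
    (B + (M ∸ A + A)) % M   ≡⟨ cong (λ x → (B + x) % M) (m∸n+n≡m A≤M) ⟩
    (B + M) % M             ≡⟨ [m+n]%n≡m%n B M ⟩
    B % M                   ≡⟨ m<n⇒m%n≡m B<M ⟩
    B                       ∎

  suc-toℕ-onto : ∀ {k} → 0 < k → k ≤ r → ∃ λ (j : Fin r) → suc (toℕ j) ≡ k
  suc-toℕ-onto {suc k} _ k<r = fromℕ< k<r , cong suc (toℕ-fromℕ< k<r)

  beaten : Fin M → Fin r → ℕ
  beaten a j = rot (toℕ a) (suc (toℕ j))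

  1+j<M : ∀ (j : Fin r) → suc (toℕ j) < M
  1+j<M j = subst (suc (suc (toℕ j)) ≤_) (sym M≡1+r+r) (≤-trans (s≤s (toℕ<n j)) (m≤m+n (suc r) r))

  beaten-injective : ∀ a → Injective _≡_ _≡_ (beaten a)
  beaten-injective a {i} {j} eq = toℕ-injective (suc-injective (rot-injective (toℕ<n a) (1+j<M i) (1+j<M j) eq))

  beaten-≢-self : ∀ a j → beaten a j ≢ toℕ a
  beaten-≢-self a j eq = 1+n≢0 (rot-injective (toℕ<n a) (1+j<M j) (m≤n+m 1 (2 * r)) (trans eq (sym (rot-zero (toℕ<n a)))))

  cyclic-tournament : ∀ a b → a ≢ b → (∃ λ j → beaten a j ≡ toℕ b) ⊎ (∃ λ j → beaten b j ≡ toℕ a)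
  cyclic-tournament a b a≢b = orient (k ≤? r)
    where
    A B k : ℕ
    A = toℕ a
    B = toℕ b
    k = rot B (M ∸ A)

    k<M : k < M
    k<M = m%n<n (B + (M ∸ A)) M

    A↝B : rot A k ≡ B
    A↝B = rot-distance (<⇒≤ (toℕ<n a)) (toℕ<n b)

    B↝A : rot B (M ∸ k) ≡ A
    B↝A = trans (cong (λ x → rot x (M ∸ k)) (sym A↝B)) (trans (rot-back A (<⇒≤ k<M)) (m<n⇒m%n≡m (toℕ<n a)))

    0<k : 0 < k
    0<k = n≢0⇒n>0 λ k≡0 → a≢b (toℕ-injective (trans (sym (rot-zero (toℕ<n a))) (trans (cong (rot A) (sym k≡0)) A↝B)))

    orient : Dec (k ≤ r) → (∃ λ j → beaten a j ≡ B) ⊎ (∃ λ j → beaten b j ≡ A)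
    orient (yes k≤r) = let j , 1+j≡k = suc-toℕ-onto 0<k k≤r in inj₁ (j , trans (cong (rot A) 1+j≡k) A↝B)
    orient (no  k≰r) = let j , 1+j≡M∸k = suc-toℕ-onto (m<n⇒0<n∸m k<M) M∸k≤r in
                       inj₂ (j , trans (cong (rot B) 1+j≡M∸k) B↝A)
      where
      M∸k≤r : M ∸ k ≤ r
      M∸k≤r = m≤n+o⇒m∸n≤o M k (subst (_≤ k + r) (sym M≡1+r+r) (+-monoˡ-≤ r (≰⇒> k≰r)))

module StarFamily {r c : ℕ} {leaf : Fin r → ℕ}
                  (leaf-injective : Injective _≡_ _≡_ leaf) (leaf≢c : ∀ j → leaf j ≢ c) where
  open CyclicTournament r

  N : ℕ
  N = suc (c + ∑[ j < r ] leaf j)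

  label : Fin (suc r) → ℕ
  label = c ∷ leaf

  label<N : ∀ k → label k < N
  label<N zero    = s≤s (m≤m+n c _)
  label<N (suc j) = s≤s (≤-trans (≤-∑ leaf j) (m≤n+m _ c))

  slot : Fin M → Fin (suc r) → ℕ
  slot a k = N + (toℕ a ∷ beaten a) k

  slot-injective : ∀ a → Injective _≡_ _≡_ (slot a)
  slot-injective a = ∷-injective (beaten-≢-self a) (beaten-injective a) ∘ +-cancelˡ-≡ N _ _

  slot≢label : ∀ a k l → slot a k ≢ label l
  slot≢label a k l eq = <⇒≢ (<-≤-trans (label<N l) (m≤m+n N _)) (sym eq)

  cyclic-family : Fin M → Perm
  cyclic-family a = transpositions _≟_ (slot a) label

  cyclic-family-slot : ∀ a k → Inverse.to (cyclic-family a) (slot a k) ≡ label k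
  cyclic-family-slot a = transpositions-maps _≟_ (slot a) label (slot≢label a) (slot-injective a)
                                           (∷-injective leaf≢c leaf-injective)

  cyclic-family-different : PairwiseDifferent (StarEdge r c leaf) M cyclic-family
  cyclic-family-different a b a≢b with cyclic-tournament a b a≢b
  ... | inj₁ (j , a↝b) = N + toℕ b , inj₂ (cyclic-family-slot b zero , j ,
          trans (sym (cyclic-family-slot a (suc j))) (cong (Inverse.to (cyclic-family a) ∘ (N +_)) a↝b))
  ... | inj₂ (j , b↝a) = N + toℕ a , inj₁ (cyclic-family-slot a zero , j ,
          trans (sym (cyclic-family-slot b (suc j))) (cong (Inverse.to (cyclic-family b) ∘ (N +_)) b↝a))

proposition4 : (r : ℕ) → 1 ≤ r → (c : ℕ) (leaf : Fin r → ℕ) →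
    Injective _≡_ _≡_ leaf → (∀ j → leaf j ≢ c) →
    KappaIs (StarEdge r c leaf) (2 * r + 1)
proposition4 r _ c leaf leaf-injective leaf≢c =
  (cyclic-family , cyclic-family-different) , λ m π different → star-pairwiseDifferent⇒≤ leaf≢c m π different
  where open StarFamily leaf-injective leaf≢c
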